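{- With the notation of the context, for every $n\ge 1$ the following hold: (a) $v_i(n)-v_i(n-1)\ge i$ for $i=1,2,3$; (b) $v_3(n)-v_1(n)\ge v_3(n-1)-v_1(n-1)+2$; (c) $\mathrm{Gap}\big(D_{n-1}\cap[\mathrm{Mex}(D_{n-1}),\infty)\big)\ge 2$; (d) $\mathrm{Gap}\big(F_{n-1}\cap[\mathrm{Mex}(F_{n-1})+\mathrm{Mex}(D_{n-1}),\infty)\big)\ge 3$; (e) $\max F_n=v_3(n)=v_2(n)+\mathrm{Mex}(D_{n-1})$; (f) $\max D_n=v_3(n)-v_1(n)$.
   Context: $\mathbb{N}_0$ denotes the non-negative integers. For $F\subset\mathbb{N}_0$ let $\mathrm{Mex}(F)=\min(\mathbb{N}_0\setminus F)$, and $a+D=\{a+d:d\in D\}$. Define recursively: $G_0=\{(0,0,0)\}$, $v(0)=(v_1(0),v_2(0),v_3(0))=(0,0,0)$; for $n\ge 0$, let $F_n$ be the set of all coordinates of all triples in $G_n$, $D_n=\bigcup_{x\in G_n}\{x_2-x_1,x_3-x_2,x_3-x_1\}$, and $v_1(n+1)=\mathrm{Mex}(F_n)$, $v_2(n+1)=\mathrm{Mex}\big((v_1(n+1)+D_n)\cup\{1,\dots,v_1(n+1)\}\cup F_n\big)$, $v_3(n+1)=\mathrm{Mex}\big((v_2(n+1)+D_n)\cup\{1,\dots,v_2(n+1)\}\cup F_n\big)$, $G_{n+1}=G_n\cup\{(v_1(n+1),v_2(n+1),v_3(n+1))\}$. For a finite set $K=\{k_1<k_2<\dots<k_\ell\}\subset\mathbb{N}_0$,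 $\mathrm{Gap}(K)=\min\{k_{i+1}-k_i: 1\le i<\ell\}$ if $\ell\ge 2$ and $\mathrm{Gap}(K)=\infty$ if $\ell\le 1$. The interval $[a,\infty)$ means the integers $\ge a$. -}

module Defs where

open import Data.Nat using (ℕ; zero; suc; _+_; _∸_; _≤_; _<_; _≤?_; _⊔_)
open import Data.Nat.Properties using (_≟_)
open import Data.List using (List; []; _∷_; _++_; map; concatMap; filter; foldr; length; upTo)
open import Data.List.Membership.Propositional using (_∈_)
open import Data.List.Membership.DecPropositional _≟_ using (_∈?_)
open import Data.Product using (_×_; _,_; proj₁; proj₂)
open import Relation.Nullary using (yes; no)

-- Search k = 0,1,...; among 0..length L some number is missing from L,
-- so the fuel length L suffices and this computes min (ℕ \ L).
mexAux : List ℕ → ℕ → ℕ → ℕ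
mexAux L k zero = k
mexAux L k (suc f) with k ∈? L
... | yes _ = mexAux L (suc k) f
... | no _  = k

Mex : List ℕ → ℕ
Mex L = mexAux L 0 (length L)

oneTo : ℕ → List ℕ
oneTo k = map suc (upTo k)

_+ˢ_ : ℕ → List ℕ → List ℕ
a +ˢ D = map (a +_) D

Triple : Set
Triple = ℕ × ℕ × ℕ

coords : Triple → List ℕ
coords (a , b , c) = a ∷ b ∷ c ∷ []

-- {x₂ - x₁, x₃ - x₂, x₃ - x₁}  (truncated subtraction; the triples are increasing)
diffs : Triple → List ℕ
diffs (a , b , c) = (b ∸ a) ∷ (c ∸ b) ∷ (c ∸ a) ∷ []

Fof : List Triple → List ℕ
Fof G = concatMap coords G

Dof : List Triple → List ℕ
Dof G = concatMap diffs G

next : List Triple → Triple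
next G = a , b , c
  where
    Fn = Fof G
    Dn = Dof G
    a = Mex Fn
    b = Mex ((a +ˢ Dn) ++ oneTo a ++ Fn)
    c = Mex ((b +ˢ Dn) ++ oneTo b ++ Fn)

Gs : ℕ → List Triple
Gs zero = (0 , 0 , 0) ∷ []
Gs (suc n) = Gs n ++ (next (Gs n) ∷ [])

v : ℕ → Triple
v zero = (0 , 0 , 0)
v (suc n) = next (Gs n)

v₁ v₂ v₃ : ℕ → ℕ
v₁ n = proj₁ (v n)
v₂ n = proj₁ (proj₂ (v n))
v₃ n = proj₂ (proj₂ (v n))

F : ℕ → List ℕ
F n = Fof (Gs n)

D : ℕ → List ℕ
D n = Dof (Gs n)

_∩≥_ : List ℕ → ℕ → List ℕ
K ∩≥ a = filter (a ≤?_) K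

-- Gap(K) ≥ k : every two elements x < y of K satisfy y - x ≥ k
-- (equivalently the minimum of consecutive differences is ≥ k; vacuous if |K| ≤ 1, Gap = ∞).
Gap≥ : List ℕ → ℕ → Set
Gap≥ K k = ∀ {x y} → x ∈ K → y ∈ K → x < y → k ≤ y ∸ x

maxL : List ℕ → ℕ
maxL = foldr _⊔_ 0

{-# OPTIONS --safe #-}
module Submission where

-- Everything follows from an invariant of (F n, D n, v n) preserved by each step. With
-- m = Mex D and a = Mex F, every number below a + m is forbidden for v₂, so v₂ ≥ a + m, and
-- v₃ = v₂ + m exactly, since v₂ + m exceeds max F while m ∉ D. The crux is that every j
-- strictly between m and v₂ − a already lies in D, as otherwise the two gap conditions
-- clash; so the new differences fill D up to v₂ − a and push Mex D past v₂ − a and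
-- v₃ − v₂ = m. The only new elements above the new thresholds are then the new maxima
-- v₃ and v₃ − v₁, which lie far enough above all old elements to keep the gaps.

open import Defs
open import Data.Nat using (ℕ; zero; suc; _+_; _∸_; _≤_; _<_; _≤?_; z≤n; s≤s; s≤s⁻¹; z<s)
open import Data.Nat.Properties
open import Data.List using (List; []; _∷_; _++_; [_]; length; concatMap)
open import Data.List.Properties using (concatMap-++; ++-identityʳ)
open import Data.List.Membership.Propositional using (_∈_; _∉_)
open import Data.List.Membership.Propositional.Properties using (∈-∃++; ∈-++⁺ˡ; ∈-++⁺ʳ; ∈-++⁻; ∈-map⁺; ∈-map⁻; ∈-upTo⁺; ∈-upTo⁻; ∈-filter⁺; ∈-filter⁻)
open import Data.List.Membership.DecPropositional _≟_ using (_∈?_)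
open import Data.List.Relation.Unary.Any using (here; there)
open import Data.List.Relation.Unary.All as All using (All; []; _∷_)
open import Data.List.Relation.Unary.All.Properties using (++⁺)
open import Data.List.Relation.Binary.Permutation.Propositional.Properties using (shift; ∈-resp-↭; ↭-length)
open import Data.Product using (_×_; _,_)
open import Data.Sum using (_⊎_; inj₁; inj₂)
open import Data.Empty using (⊥-elim)
open import Relation.Nullary using (yes; no)
open import Relation.Binary.Definitions using (tri<; tri≈; tri>)
open import Relation.Binary.PropositionalEquality using (_≡_; refl; sym; trans; cong; subst; subst₂; module ≡-Reasoning)
open import Data.Integer as ℤ using (+_)
open import Data.Integer.Properties using (m-n≡m⊖n; ⊖-≥)

private variable
  j k s t t′ x y z : ℕ
  L K K′ Δ Φ : List ℕ

infix 4 ↓_⊆_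

↓_⊆_ : ℕ → List ℕ → Set
↓ k ⊆ L = ∀ {j} → j < k → j ∈ L

↓-suc : ↓ k ⊆ L → k ∈ L → ↓ suc k ⊆ L
↓-suc below k∈L j<1+k with m≤n⇒m<n∨m≡n (s≤s⁻¹ j<1+k)
... | inj₁ j<k  = below j<k
... | inj₂ refl = k∈L

↓⊆⇒≤length : ↓ k ⊆ L → k ≤ length L
↓⊆⇒≤length {zero}  _ = z≤n
↓⊆⇒≤length {suc k} below with ∈-∃++ (below ≤-refl)
... | ys , zs , refl = begin
  suc k                    ≤⟨ s≤s (↓⊆⇒≤length rest) ⟩
  suc (length (ys ++ zs))  ≡⟨ ↭-length (shift k ys zs) ⟨
  length (ys ++ k ∷ zs)    ∎
  where
    open ≤-Reasoning
    rest : ↓ k ⊆ ys ++ zs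
    rest j<k with ∈-resp-↭ (shift k ys zs) (below (m<n⇒m<1+n j<k))
    ... | here refl = ⊥-elim (<-irrefl refl j<k)
    ... | there j∈  = j∈

mexAux-↓ : ∀ L k f → ↓ k ⊆ L → ↓ mexAux L k f ⊆ L
mexAux-↓ L k zero    below = below
mexAux-↓ L k (suc f) below with k ∈? L
... | yes k∈L = mexAux-↓ L (suc k) f (↓-suc below k∈L)
... | no  _   = below

-- Running out of fuel would leave length L + 1 distinct members in L.
mexAux-∉ : ∀ L k f → k + f ≡ length L → ↓ k ⊆ L → mexAux L k f ∉ L
mexAux-∉ L k zero k≡len below k∈L =
  1+n≰n (≤-trans (↓⊆⇒≤length (↓-suc below k∈L)) (≤-reflexive (trans (sym k≡len) (+-identityʳ k))))
mexAux-∉ L k (suc f) k+f≡len below with k ∈? L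
... | yes k∈L = mexAux-∉ L (suc k) f (trans (sym (+-suc k f)) k+f≡len) (↓-suc below k∈L)
... | no  k∉L = k∉L

↓Mex⊆ : ∀ L → ↓ Mex L ⊆ L
↓Mex⊆ L = mexAux-↓ L 0 (length L) λ ()

Mex∉ : ∀ L → Mex L ∉ L
Mex∉ L = mexAux-∉ L 0 (length L) refl λ ()

Mex-≤ : k ∉ L → Mex L ≤ k
Mex-≤ {L = L} k∉L = ≮⇒≥ λ k<Mex → k∉L (↓Mex⊆ L k<Mex)

Mex-≥ : ↓ k ⊆ L → k ≤ Mex L
Mex-≥ {L = L} below = ≮⇒≥ λ Mex<k → Mex∉ L (below Mex<k)

Mex-≡ : ↓ k ⊆ L → k ∉ L → Mex L ≡ k
Mex-≡ below k∉L = ≤-antisym (Mex-≤ k∉L) (Mex-≥ below)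

0∈⇒Mex>0 : 0 ∈ L → 0 < Mex L
0∈⇒Mex>0 0∈L = Mex-≥ (↓-suc (λ ()) 0∈L)

Mex>0⇒0∈ : k < Mex L → 0 ∈ L
Mex>0⇒0∈ {L = L} k<Mex = ↓Mex⊆ L (≤-<-trans z≤n k<Mex)

maxL-lub : All (_≤ z) L → maxL L ≤ z
maxL-lub []           = z≤n
maxL-lub (x≤z ∷ rest) = ⊔-lub x≤z (maxL-lub rest)

maxL-ub : x ∈ L → x ≤ maxL L
maxL-ub {L = y ∷ L} (here refl) = m≤m⊔n y (maxL L)
maxL-ub {L = y ∷ L} (there x∈L) = ≤-trans (maxL-ub x∈L) (m≤n⊔m y (maxL L))

maxL-≡ : z ∈ L → All (_≤ z) L → maxL L ≡ z
maxL-≡ z∈L bound = ≤-antisym (maxL-lub bound) (maxL-ub z∈L)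

Gap≥-apply : Gap≥ (K ∩≥ t) k → x ∈ K → y ∈ K → t ≤ x → x < y → k ≤ y ∸ x
Gap≥-apply {t = t} gap x∈K y∈K t≤x x<y =
  gap (∈-filter⁺ (t ≤?_) x∈K t≤x) (∈-filter⁺ (t ≤?_) y∈K (≤-trans t≤x (<⇒≤ x<y))) x<y

Gap≥-extend : Gap≥ (K ∩≥ t) k → t ≤ t′ → All (λ x → x + k ≤ z) K →
              (∀ {x} → x ∈ K′ → t′ ≤ x → x ∈ K ⊎ x ≡ z) → Gap≥ (K′ ∩≥ t′) k
Gap≥-extend {k = k} {t′ = t′} gap t≤t′ below-z classify {x} x∈ y∈ x<y
  with ∈-filter⁻ (t′ ≤?_) x∈ | ∈-filter⁻ (t′ ≤?_) y∈
... | x∈K′ , t′≤x | y∈K′ , t′≤y with classify x∈K′ t′≤x | classify y∈K′ t′≤y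
... | inj₁ x∈K | inj₁ y∈K  = Gap≥-apply gap x∈K y∈K (≤-trans t≤t′ t′≤x) x<y
... | inj₁ x∈K | inj₂ refl = m+n≤o⇒m≤o∸n k (≤-trans (≤-reflexive (+-comm k x)) (All.lookup below-z x∈K))
... | inj₂ refl | inj₁ y∈K = ⊥-elim (<⇒≱ x<y (≤-trans (m≤m+n _ _) (All.lookup below-z y∈K)))
... | inj₂ refl | inj₂ refl = ⊥-elim (<-irrefl refl x<y)

concatMap-∷ʳ : ∀ {A B : Set} (f : A → List B) xs x → concatMap f (xs ++ [ x ]) ≡ concatMap f xs ++ f x
concatMap-∷ʳ f xs x = trans (concatMap-++ f xs [ x ]) (cong (concatMap f xs ++_) (++-identityʳ (f x)))

-- next in Defs takes v₂ = Mex (forbidden v₁ D F) and v₃ = Mex (forbidden v₂ D F).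
forbidden : ℕ → List ℕ → List ℕ → List ℕ
forbidden s Δ Φ = (s +ˢ Δ) ++ oneTo s ++ Φ

∈oneTo⇒≤ : x ∈ oneTo s → x ≤ s
∈oneTo⇒≤ x∈ with _ , y∈ , refl ← ∈-map⁻ suc x∈ = ∈-upTo⁻ y∈

↓forbidden : 0 ∈ Φ → ↓ s + Mex Δ ⊆ forbidden s Δ Φ
↓forbidden {s = s} {Δ = Δ} 0∈Φ {zero} _ = ∈-++⁺ʳ (s +ˢ Δ) (∈-++⁺ʳ (oneTo s) 0∈Φ)
↓forbidden {s = s} {Δ = Δ} 0∈Φ {suc j} j<s+m with suc j ≤? s
... | yes 1+j≤s = ∈-++⁺ʳ (s +ˢ Δ) (∈-++⁺ˡ (∈-map⁺ suc (∈-upTo⁺ 1+j≤s)))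
... | no  1+j≰s = ∈-++⁺ˡ (subst (_∈ s +ˢ Δ) (m+[n∸m]≡n s≤1+j) (∈-map⁺ (_+_ s) (↓Mex⊆ Δ d<m)))
  where
    s≤1+j : s ≤ suc j
    s≤1+j = ≰⇒≥ 1+j≰s
    d<m : suc j ∸ s < Mex Δ
    d<m = +-cancelˡ-< s _ _ (subst (_< s + Mex Δ) (sym (m+[n∸m]≡n s≤1+j)) j<s+m)

∈forbidden⁻ : 0 < k → s + k ∈ forbidden s Δ Φ → k ∈ Δ ⊎ s + k ∈ Φ
∈forbidden⁻ {k = k} {s = s} {Δ = Δ} k>0 p with ∈-++⁻ (s +ˢ Δ) p
... | inj₁ q with d , d∈Δ , s+k≡s+d ← ∈-map⁻ (_+_ s) q = inj₁ (subst (_∈ Δ) (sym (+-cancelˡ-≡ s k d s+k≡s+d)) d∈Δ)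
... | inj₂ q with ∈-++⁻ (oneTo s) q
...   | inj₁ r = ⊥-elim (<⇒≱ (m<m+n s k>0) (∈oneTo⇒≤ r))
...   | inj₂ r = inj₂ r

Mex-forbidden-≥ : 0 ∈ Φ → s + Mex Δ ≤ Mex (forbidden s Δ Φ)
Mex-forbidden-≥ {s = s} {Δ = Δ} 0∈Φ = Mex-≥ (↓forbidden {s = s} {Δ = Δ} 0∈Φ)

Mex-forbidden-≡ : 0 ∈ Φ → 0 ∈ Δ → All (_< s + Mex Δ) Φ → Mex (forbidden s Δ Φ) ≡ s + Mex Δ
Mex-forbidden-≡ {Φ = Φ} {Δ = Δ} {s = s} 0∈Φ 0∈Δ Φ<s+m = Mex-≡ (↓forbidden {s = s} {Δ = Δ} 0∈Φ) s+m∉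
  where
    s+m∉ : s + Mex Δ ∉ forbidden s Δ Φ
    s+m∉ p with ∈forbidden⁻ (0∈⇒Mex>0 0∈Δ) p
    ... | inj₁ m∈Δ   = Mex∉ Δ m∈Δ
    ... | inj₂ s+m∈Φ = <-irrefl refl (All.lookup Φ<s+m s+m∈Φ)

-- If s + j ∈ Φ for some j in the window, the gap in Φ keeps s + m + 1 and s + m + 2 out of Φ,
-- so m + 1 and m + 2 lie in Δ, against the gap in Δ above its Mex m.
module _ (0∈Δ : 0 ∈ Δ) (gapΔ : Gap≥ (Δ ∩≥ Mex Δ) 2) (gapΦ : Gap≥ (Φ ∩≥ (Mex Φ + Mex Δ)) 3) (MexΦ≤s : Mex Φ ≤ s) where
  private
    m b : ℕ
    m = Mex Δ
    b = Mex (forbidden s Δ Φ)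

    shift∈Δ⊎Φ : 0 < k → s + k < b → k ∈ Δ ⊎ s + k ∈ Φ
    shift∈Δ⊎Φ k>0 s+k<b = ∈forbidden⁻ k>0 (↓Mex⊆ _ s+k<b)

    s+m∈Φ : s + m < b → s + m ∈ Φ
    s+m∈Φ s+m<b with shift∈Δ⊎Φ (0∈⇒Mex>0 0∈Δ) s+m<b
    ... | inj₁ m∈Δ   = ⊥-elim (Mex∉ Δ m∈Δ)
    ... | inj₂ s+m∈Φ = s+m∈Φ

    shift-gap : s + m ∈ Φ → s + k ∈ Φ → m < k → 3 ≤ k ∸ m
    shift-gap {k} s+m∈Φ s+k∈Φ m<k = subst (3 ≤_) ([m+n]∸[m+o]≡n∸o s k m)
      (Gap≥-apply gapΦ s+m∈Φ s+k∈Φ (+-monoˡ-≤ m MexΦ≤s) (+-monoʳ-< s m<k))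

    no-Φ-in-window : m < j → s + j < b → s + j ∉ Φ
    no-Φ-in-window {j} m<j s+j<b s+j∈Φ = 1+n≰n (begin
      2                       ≤⟨ Gap≥-apply gapΔ (m+k∈Δ 1 z<s (s≤s z≤n)) (m+k∈Δ 2 z<s ≤-refl) (m≤m+n m 1) (+-monoʳ-< m ≤-refl) ⟩
      (m + 2) ∸ (m + 1)       ≡⟨ [m+n]∸[m+o]≡n∸o m 2 1 ⟩
      1                       ∎)
      where
        open ≤-Reasoning
        s+m∈ : s + m ∈ Φ
        s+m∈ = s+m∈Φ (<-trans (+-monoʳ-< s m<j) s+j<b)
        m+3≤j : m + 3 ≤ j
        m+3≤j = subst (_≤ j) (+-comm 3 m) (m≤o∸n⇒m+n≤o 3 (<⇒≤ m<j) (shift-gap s+m∈ s+j∈Φ m<j))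
        m+k∈Δ : ∀ k → 0 < k → k ≤ 2 → m + k ∈ Δ
        m+k∈Δ k k>0 k≤2 with shift∈Δ⊎Φ (<-≤-trans k>0 (m≤n+m k m)) (<-trans (+-monoʳ-< s (<-≤-trans (+-monoʳ-< m (s≤s k≤2)) m+3≤j)) s+j<b)
        ... | inj₁ m+k∈Δ   = m+k∈Δ
        ... | inj₂ s+m+k∈Φ = ⊥-elim (<⇒≱ (s≤s k≤2) (subst (3 ≤_) (m+n∸m≡n m k) (shift-gap s+m∈ s+m+k∈Φ (m<m+n m k>0))))

  window⊆Δ : Mex Δ < j → s + j < Mex (forbidden s Δ Φ) → j ∈ Δ
  window⊆Δ m<j s+j<b with shift∈Δ⊎Φ (<-≤-trans (0∈⇒Mex>0 0∈Δ) (<⇒≤ m<j)) s+j<b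
  ... | inj₁ j∈Δ   = j∈Δ
  ... | inj₂ s+j∈Φ = ⊥-elim (no-Φ-in-window m<j s+j<b s+j∈Φ)

+-<-step : x < z → y + k ≤ t → x + y + suc k ≤ z + t
+-<-step {x} {z} {y} {k} {t} x<z y+k≤t = begin
  x + y + suc k    ≡⟨ +-assoc x y (suc k) ⟩
  x + (y + suc k)  ≡⟨ cong (_+_ x) (+-suc y k) ⟩
  x + suc (y + k)  ≡⟨ +-suc x (y + k) ⟩
  suc x + (y + k)  ≤⟨ +-mono-≤ x<z y+k≤t ⟩
  z + t            ∎
  where open ≤-Reasoning

∸-+-∸ : x ≤ y → y ≤ z → (z ∸ y) + (y ∸ x) ≡ z ∸ x
∸-+-∸ {x} {y} {z} x≤y y≤z = begin
  (z ∸ y) + (y ∸ x)  ≡⟨ +-∸-assoc (z ∸ y) x≤y ⟨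
  (z ∸ y) + y ∸ x    ≡⟨ cong (_∸ x) (m∸n+n≡m y≤z) ⟩
  z ∸ x              ∎
  where open ≡-Reasoning

<⇒+1≤ : x < y → x + 1 ≤ y
<⇒+1≤ {x} {y} = subst (_≤ y) (+-comm 1 x)

record Invariant (Φ Δ : List ℕ) (A B C : ℕ) : Set where
  field
    A≤B      : A ≤ B
    B≤C      : B ≤ C
    C∈Φ      : C ∈ Φ
    Φ≤C      : All (_≤ C) Φ
    C∸A∈Δ    : C ∸ A ∈ Δ
    Δ≤C∸A    : All (_≤ C ∸ A) Δ
    A<MexΦ   : A < Mex Φ
    B∸A<MexΔ : B ∸ A < Mex Δ
    C∸B<MexΔ : C ∸ B < Mex Δ
    gapΔ     : Gap≥ (Δ ∩≥ Mex Δ) 2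
    gapΦ     : Gap≥ (Φ ∩≥ (Mex Φ + Mex Δ)) 3

  A≤C : A ≤ C
  A≤C = ≤-trans A≤B B≤C

module Step {Φ Δ A B C} (I : Invariant Φ Δ A B C) where
  open Invariant I

  m a b c : ℕ
  m = Mex Δ
  a = Mex Φ
  b = Mex (forbidden a Δ Φ)
  c = Mex (forbidden b Δ Φ)

  Φ′ Δ′ : List ℕ
  Φ′ = Φ ++ a ∷ b ∷ c ∷ []
  Δ′ = Δ ++ (b ∸ a) ∷ (c ∸ b) ∷ (c ∸ a) ∷ []

  0∈Φ : 0 ∈ Φ
  0∈Φ = Mex>0⇒0∈ A<MexΦ

  0∈Δ : 0 ∈ Δ
  0∈Δ = Mex>0⇒0∈ B∸A<MexΔ

  a+m≤b : a + m ≤ b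
  a+m≤b = Mex-forbidden-≥ {s = a} {Δ = Δ} 0∈Φ

  A+1≤a : A + 1 ≤ a
  A+1≤a = <⇒+1≤ A<MexΦ

  B+2≤b : B + 2 ≤ b
  B+2≤b = begin
    B + 2            ≡⟨ cong (_+ 2) (m∸n+n≡m A≤B) ⟨
    (B ∸ A) + A + 2  ≤⟨ +-<-step B∸A<MexΔ A+1≤a ⟩
    m + a            ≡⟨ +-comm m a ⟩
    a + m            ≤⟨ a+m≤b ⟩
    b                ∎
    where open ≤-Reasoning

  C+3≤b+m : C + 3 ≤ b + m
  C+3≤b+m = begin
    C + 3            ≡⟨ cong (_+ 3) (m∸n+n≡m B≤C) ⟨
    (C ∸ B) + B + 3  ≤⟨ +-<-step C∸B<MexΔ B+2≤b ⟩
    m + b            ≡⟨ +-comm m b ⟩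
    b + m            ∎
    where open ≤-Reasoning

  c≡b+m : c ≡ b + m
  c≡b+m = Mex-forbidden-≡ {s = b} 0∈Φ 0∈Δ (All.map (λ x≤C → ≤-<-trans x≤C (<-≤-trans (m<m+n C z<s) C+3≤b+m)) Φ≤C)

  C+3≤c : C + 3 ≤ c
  C+3≤c = subst (C + 3 ≤_) (sym c≡b+m) C+3≤b+m

  a≤b : a ≤ b
  a≤b = ≤-trans (m≤m+n a m) a+m≤b

  b≤c : b ≤ c
  b≤c = subst (b ≤_) (sym c≡b+m) (m≤m+n b m)

  m≤b∸a : m ≤ b ∸ a
  m≤b∸a = m+n≤o⇒m≤o∸n m (subst (_≤ b) (+-comm a m) a+m≤b)

  c∸b≡m : c ∸ b ≡ m
  c∸b≡m = trans (cong (_∸ b) c≡b+m) (m+n∸m≡n b m)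

  C∸A+2≤c∸a : (C ∸ A) + 2 ≤ c ∸ a
  C∸A+2≤c∸a = begin
    (C ∸ A) + 2                ≡⟨ cong (_+ 2) (∸-+-∸ A≤B B≤C) ⟨
    (C ∸ B) + (B ∸ A) + 2      ≤⟨ +-<-step C∸B<MexΔ (<⇒+1≤ B∸A<MexΔ) ⟩
    m + m                      ≤⟨ +-monoˡ-≤ m m≤b∸a ⟩
    (b ∸ a) + m                ≡⟨ +-∸-comm m a≤b ⟨
    b + m ∸ a                  ≡⟨ cong (_∸ a) c≡b+m ⟨
    c ∸ a                      ∎
    where open ≤-Reasoning

  ↓Δ′ : ↓ suc (b ∸ a) ⊆ Δ′
  ↓Δ′ {j} j≤b∸a with <-cmp j m
  ... | tri< j<m _ _  = ∈-++⁺ˡ (↓Mex⊆ Δ j<m)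
  ... | tri≈ _ refl _ = ∈-++⁺ʳ Δ (there (here (sym c∸b≡m)))
  ... | tri> _ _ m<j with m≤n⇒m<n∨m≡n (s≤s⁻¹ j≤b∸a)
  ...   | inj₁ j<b∸a = ∈-++⁺ˡ (window⊆Δ {Φ = Φ} {s = a} 0∈Δ gapΔ gapΦ ≤-refl m<j a+j<b)
    where
      a+j<b : a + j < b
      a+j<b = subst (a + j <_) (m+[n∸m]≡n a≤b) (+-monoʳ-< a j<b∸a)
  ...   | inj₂ refl  = ∈-++⁺ʳ Δ (here refl)

  b∸a<MexΔ′ : b ∸ a < Mex Δ′
  b∸a<MexΔ′ = Mex-≥ ↓Δ′

  m≤MexΔ′ : m ≤ Mex Δ′
  m≤MexΔ′ = ≤-trans m≤b∸a (<⇒≤ b∸a<MexΔ′)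

  c∸b<MexΔ′ : c ∸ b < Mex Δ′
  c∸b<MexΔ′ = subst (_< Mex Δ′) (sym c∸b≡m) (≤-<-trans m≤b∸a b∸a<MexΔ′)

  a<MexΦ′ : a < Mex Φ′
  a<MexΦ′ = Mex-≥ (↓-suc (λ j<a → ∈-++⁺ˡ (↓Mex⊆ Φ j<a)) (∈-++⁺ʳ Φ (here refl)))

  b<MexΦ′+MexΔ′ : b < Mex Φ′ + Mex Δ′
  b<MexΦ′+MexΔ′ = subst (_< Mex Φ′ + Mex Δ′) (m+[n∸m]≡n a≤b) (+-mono-< a<MexΦ′ b∸a<MexΔ′)

  Δ′-above-MexΔ′ : x ∈ Δ′ → Mex Δ′ ≤ x → x ∈ Δ ⊎ x ≡ c ∸ a
  Δ′-above-MexΔ′ x∈Δ′ MexΔ′≤x with ∈-++⁻ Δ x∈Δ′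
  ... | inj₁ x∈Δ                         = inj₁ x∈Δ
  ... | inj₂ (here refl)                 = ⊥-elim (<⇒≱ b∸a<MexΔ′ MexΔ′≤x)
  ... | inj₂ (there (here refl))         = ⊥-elim (<⇒≱ c∸b<MexΔ′ MexΔ′≤x)
  ... | inj₂ (there (there (here refl))) = inj₂ refl

  Φ′-above-MexΦ′+MexΔ′ : x ∈ Φ′ → Mex Φ′ + Mex Δ′ ≤ x → x ∈ Φ ⊎ x ≡ c
  Φ′-above-MexΦ′+MexΔ′ x∈Φ′ T≤x with ∈-++⁻ Φ x∈Φ′
  ... | inj₁ x∈Φ                         = inj₁ x∈Φ
  ... | inj₂ (here refl)                 = ⊥-elim (<⇒≱ (≤-<-trans a≤b b<MexΦ′+MexΔ′) T≤x)
  ... | inj₂ (there (here refl))         = ⊥-elim (<⇒≱ b<MexΦ′+MexΔ′ T≤x)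
  ... | inj₂ (there (there (here refl))) = inj₂ refl

  Φ+3≤c : All (λ x → x + 3 ≤ c) Φ
  Φ+3≤c = All.map (λ x≤C → ≤-trans (+-monoˡ-≤ 3 x≤C) C+3≤c) Φ≤C

  Δ+2≤c∸a : All (λ x → x + 2 ≤ c ∸ a) Δ
  Δ+2≤c∸a = All.map (λ x≤C∸A → ≤-trans (+-monoˡ-≤ 2 x≤C∸A) C∸A+2≤c∸a) Δ≤C∸A

  invariant′ : Invariant Φ′ Δ′ a b c
  invariant′ = record
    { A≤B      = a≤b
    ; B≤C      = b≤c
    ; C∈Φ      = ∈-++⁺ʳ Φ (there (there (here refl)))
    ; Φ≤C      = ++⁺ (All.map (≤-trans (m≤m+n _ 3)) Φ+3≤c) (≤-trans a≤b b≤c ∷ b≤c ∷ ≤-refl ∷ [])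
    ; C∸A∈Δ    = ∈-++⁺ʳ Δ (there (there (here refl)))
    ; Δ≤C∸A    = ++⁺ (All.map (≤-trans (m≤m+n _ 2)) Δ+2≤c∸a) (∸-monoˡ-≤ a b≤c ∷ ∸-monoʳ-≤ c a≤b ∷ ≤-refl ∷ [])
    ; A<MexΦ   = a<MexΦ′
    ; B∸A<MexΔ = b∸a<MexΔ′
    ; C∸B<MexΔ = c∸b<MexΔ′
    ; gapΔ     = Gap≥-extend gapΔ m≤MexΔ′ Δ+2≤c∸a Δ′-above-MexΔ′
    ; gapΦ     = Gap≥-extend gapΦ (+-mono-≤ (<⇒≤ a<MexΦ′) m≤MexΔ′) Φ+3≤c Φ′-above-MexΦ′+MexΔ′
    }

invariant : ∀ n → Invariant (F n) (D n) (v₁ n) (v₂ n) (v₃ n)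
-- F 0 and D 0 both compute to 0 ∷ 0 ∷ 0 ∷ [], whose Mex is 1; nothing survives the thresholds.
invariant zero = record
  { A≤B = z≤n ; B≤C = z≤n ; C∈Φ = here refl ; Φ≤C = z≤n ∷ z≤n ∷ z≤n ∷ []
  ; C∸A∈Δ = here refl ; Δ≤C∸A = z≤n ∷ z≤n ∷ z≤n ∷ []
  ; A<MexΦ = z<s ; B∸A<MexΔ = z<s ; C∸B<MexΔ = z<s
  ; gapΔ = λ () ; gapΦ = λ ()
  }
invariant (suc n) =
  subst₂ (λ Φ Δ → Invariant Φ Δ (v₁ (suc n)) (v₂ (suc n)) (v₃ (suc n)))
    (sym (concatMap-∷ʳ coords (Gs n) (v (suc n)))) (sym (concatMap-∷ʳ diffs (Gs n) (v (suc n))))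
    (Step.invariant′ (invariant n))

+x-+y≡+[x∸y] : y ≤ x → + x ℤ.- + y ≡ + (x ∸ y)
+x-+y≡+[x∸y] {y} {x} y≤x = trans (m-n≡m⊖n x y) (⊖-≥ y≤x)

theorem3 : (n : ℕ) → 1 ≤ n →
    (((+ v₁ (n ∸ 1)) ℤ.+ (+ 1) ℤ.≤ (+ v₁ n))
      × ((+ v₂ (n ∸ 1)) ℤ.+ (+ 2) ℤ.≤ (+ v₂ n))
      × ((+ v₃ (n ∸ 1)) ℤ.+ (+ 3) ℤ.≤ (+ v₃ n)))
    × ((+ v₃ (n ∸ 1)) ℤ.- (+ v₁ (n ∸ 1)) ℤ.+ (+ 2) ℤ.≤ (+ v₃ n) ℤ.- (+ v₁ n))
    × Gap≥ (D (n ∸ 1) ∩≥ (Mex (D (n ∸ 1)))) 2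
    × Gap≥ (F (n ∸ 1) ∩≥ (Mex (F (n ∸ 1)) + Mex (D (n ∸ 1)))) 3
    × (maxL (F n) ≡ v₃ n × v₃ n ≡ v₂ n + Mex (D (n ∸ 1)))
    × maxL (D n) ≡ v₃ n ∸ v₁ n
theorem3 (suc n) _ =
    (ℤ.+≤+ A+1≤a , ℤ.+≤+ B+2≤b , ℤ.+≤+ C+3≤c)
  , subst₂ (λ i j → i ℤ.+ + 2 ℤ.≤ j) (sym (+x-+y≡+[x∸y] (A≤C I))) (sym (+x-+y≡+[x∸y] (A≤C I′))) (ℤ.+≤+ C∸A+2≤c∸a)
  , gapΔ I
  , gapΦ I
  , (maxL-≡ (C∈Φ I′) (Φ≤C I′) , c≡b+m)
  , maxL-≡ (C∸A∈Δ I′) (Δ≤C∸A I′)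
  where
    I : Invariant (F n) (D n) (v₁ n) (v₂ n) (v₃ n)
    I = invariant n
    I′ : Invariant (F (suc n)) (D (suc n)) (v₁ (suc n)) (v₂ (suc n)) (v₃ (suc n))
    I′ = invariant (suc n)
    open Step I
    open Invariant using (A≤C; C∈Φ; Φ≤C; C∸A∈Δ; Δ≤C∸A; gapΔ; gapΦ)
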